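{- Let $k\in\mathbb{N}$ be even and let $m,n$ be odd integers. Then $$2K_{k,1}\left(\tfrac{n}{2},\tfrac{m}{2}\right)=K_{k,2}(n,m)=H_{2k}(n,m)\qquad\text{and}\qquad K_{k,1}(n,m)=H_k(n,m).$$
   Context: For $K\in\mathbb{N}$ and integers $n,m$, the Kloosterman sum is $$H_K(n,m):= \sum_{\substack{0 \leq h <K\\\gcd(h,K)=1}} e^{ -\frac{2\pi i }{K} \left(nh-mw \right)},$$ where for each $h$, $w$ is an integer with $hw\equiv -1\pmod K$. For even $k\in\mathbb{N}$ put $k^*:=4k$ if $\gcd(k,6)=2$ and $k^*:=36k$ if $6\mid k$. For $a\in\{1,2\}$ and $n,m\in\frac12\mathbb{Z}$ define $$K_{k,a}(n,m):= \sum_{\substack{0\leq h<ak\\ \gcd(h,ak)=1 }}e^{\frac{2\pi i}{ak} \left(-nh+mh' \right)},$$ where for each $h$, $h'$ denotes an integer with $hh'\equiv -1 \pmod{k^*}$. -}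

module Defs where

open import Level using (Level)
open import Data.Nat as ℕ using (ℕ; zero; suc)
open import Data.Nat.Divisibility as ℕD using ()
open import Data.Nat.Coprimality using (Coprime; coprime?)
open import Data.Integer as ℤ using (ℤ; +_)
import Data.Integer.Divisibility as ℤD
open import Data.Rational as ℚ using (ℚ)
open import Data.List using (List; map; foldr; filter; upTo)
open import Relation.Nullary using (yes; no)
open import Algebra.Bundles using (CommutativeRing)

-- k* : 36k if 6 ∣ k, otherwise 4k (for even k: 4k iff gcd(k,6)=2)
kstar : ℕ → ℕ
kstar k with 6 ℕD.∣? k
... | yes _ = 36 ℕ.* k
... | no  _ = 4 ℕ.* k

-- the rational number z / d (d is always nonzero where used; 0 for d = 0)
frac : ℤ → ℕ → ℚ
frac z zero    = ℚ.0ℚ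
frac z (suc d) = z ℚ./ suc d

ι : ℤ → ℚ
ι z = frac z 1

units : ℕ → List ℕ
units N = filter (λ h → coprime? h N) (upTo N)

_≡[mod_]_ : ℤ → ℕ → ℤ → Set
x ≡[mod N ] y = (+ N) ℤD.∣ (x ℤ.- y)

IsNegInvChoice : (N M : ℕ) → (ℕ → ℤ) → Set
IsNegInvChoice N M inv = ∀ h → Coprime h N → ((+ h) ℤ.* inv h) ≡[mod M ] (ℤ.- (+ 1))

-- An additive character e : ℚ → R^× trivial on ℤ (e.g. x ↦ exp(2πix) into ℂ)
record Character {c ℓ : Level} (R : CommutativeRing c ℓ) : Set (Level._⊔_ c ℓ) where
  open CommutativeRing R
  field
    e      : ℚ → Carrier
    e-hom  : ∀ x y → e (x ℚ.+ y) ≈ e x * e y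
    e-int  : ∀ z → e (ι z) ≈ 1#

module Sums {c ℓ : Level} (R : CommutativeRing c ℓ) (χ : Character R) where
  open CommutativeRing R
  open Character χ

  Σ[_]_ : List ℕ → (ℕ → Carrier) → Carrier
  Σ[ xs ] f = foldr (λ x acc → f x + acc) 0# xs

  -- H_K(n,m) = Σ_{0≤h<K, (h,K)=1} e(-(n h - m w)/K), h w ≡ -1 (mod K), w chosen by `w`
  H : (K : ℕ) → (w : ℕ → ℤ) → ℤ → ℤ → Carrier
  H K w n m = Σ[ units K ] (λ h →
    e (ℚ.- ((ι n ℚ.* ι (+ h) ℚ.- ι m ℚ.* ι (w h)) ℚ.* frac (+ 1) K)))

  -- K_{k,a}(n,m) = Σ_{0≤h<ak, (h,ak)=1} e((-n h + m h')/(ak)), h h' ≡ -1 (mod k*), h' chosen by `h'`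
  Kl : (k a : ℕ) → (h' : ℕ → ℤ) → ℚ → ℚ → Carrier
  Kl k a h' n m = Σ[ units (a ℕ.* k) ] (λ h →
    e (((ℚ.- n) ℚ.* ι (+ h) ℚ.+ m ℚ.* ι (h' h)) ℚ.* frac (+ 1) (a ℕ.* k)))

{-# OPTIONS --safe #-}
-- Every summand of H_N(n,m) and of K_{k,a}(n,m) is e(φ/N) for the integer phase φ = -nh + mx, where
-- x is the chosen negative inverse of h.  As e is trivial on ℤ, e(φ/N) depends only on φ mod N, and
-- φ mod N does not depend on which negative inverse modulo a multiple of N was chosen; this gives
-- K_{k,a}(n,m) = H_{ak}(n,m).  The terms of 2K_{k,1}(n/2,m/2) are e(φ/2k) over the units h mod k,
-- each counted twice.  For even k the units mod 2k are the h and k + h with h a unit mod k, and if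
-- x, y are negative inverses of h, k + h mod 2k then parity forces y ≡ x + k (mod 2k); the two phases
-- then differ by k(m - n) ≡ 0 (mod 2k) because m and n are odd.

module Submission where

open import Defs
open import Level using (Level)
open import Data.Nat as ℕ using (ℕ; NonZero; zero; suc; s≤s)
import Data.Nat.Properties as ℕₚ
open import Data.Nat.Divisibility as ℕD using ()
open import Data.Nat.Coprimality as ℕC using (Coprime; coprime?)
open import Data.Integer as ℤ using (ℤ; +_)
import Data.Integer.Properties as ℤₚ
import Data.Integer.Divisibility as ℤD
open import Data.Integer.Divisibility.Signed as ℤS using (_∣_; divides)
import Data.Integer.Coprimality as ℤC
open import Data.Integer.DivMod using (_%ℕ_; _/ℕ_; n%ℕd<d; a≡a%ℕn+[a/ℕn]*n)
open import Data.Integer.Tactic.RingSolver using (solve-∀)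
open import Data.Rational as ℚ using (ℚ)
import Data.Rational.Properties as ℚₚ
open import Data.Rational.Solver using (module +-*-Solver)
open import Data.Rational.Unnormalised using (mkℚᵘ; *≡*; _≃_)
import Data.Rational.Unnormalised.Properties as ℚᵘₚ
open import Data.List using ([]; _∷_; _++_; map; filter; upTo; applyUpTo)
import Data.List.Properties as Listₚ
open import Data.List.Relation.Unary.All as All using (All; []; _∷_)
open import Data.List.Relation.Unary.All.Properties using (all-filter)
open import Data.Product using (_×_; _,_; proj₁; proj₂)
open import Data.Bool using (true; false)
open import Data.Empty using (⊥-elim)
open import Function using (_∘_; id)
open import Relation.Nullary using (¬_; does; yes; no)
open import Relation.Unary using (Pred; Decidable; _≐_)
open import Relation.Binary.PropositionalEquality as ≡ using (_≡_; refl; cong; cong₂)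
open import Algebra.Bundles using (CommutativeRing)

coprime-∣ʳ : ∀ {m n d} → Coprime m n → d ℕD.∣ n → Coprime m d
coprime-∣ʳ m⊥n d∣n (i∣m , i∣d) = m⊥n (i∣m , ℕD.∣-trans i∣d d∣n)

coprime-* : ∀ {m a b} → Coprime m a → Coprime m b → Coprime m (a ℕ.* b)
coprime-* {m} {a} m⊥a m⊥b {i} (i∣m , i∣ab) = m⊥b (i∣m , ℕC.coprime-divisor i⊥a i∣ab)
  where
  i⊥a : Coprime i a
  i⊥a (j∣i , j∣a) = m⊥a (ℕD.∣-trans j∣i i∣m , j∣a)

coprime-+⁻ : ∀ {m n} → Coprime (n ℕ.+ m) n → Coprime m n
coprime-+⁻ n+m⊥n (i∣m , i∣n) = n+m⊥n (ℕD.∣m∣n⇒∣m+n i∣n i∣m , i∣n)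

coprime-double : ∀ {k} → 2 ℕD.∣ k → (λ h → Coprime h (2 ℕ.* k)) ≐ (λ h → Coprime h k)
coprime-double 2∣k = (λ h⊥2k → coprime-∣ʳ h⊥2k (ℕD.n∣m*n 2))
                   , (λ h⊥k → coprime-* (coprime-∣ʳ h⊥k 2∣k) h⊥k)

coprime-shift : ∀ {k} → (λ h → Coprime (k ℕ.+ h) k) ≐ (λ h → Coprime h k)
coprime-shift = coprime-+⁻ , ℕC.coprime-+

2k∣kstar : ∀ k → 2 ℕ.* k ℕD.∣ kstar k
2k∣kstar k with 6 ℕD.∣? k
... | yes _ = ℕD.divides 18 (ℕₚ.*-assoc 18 2 k)
... | no _  = ℕD.divides 2 (ℕₚ.*-assoc 2 2 k)

applyUpTo-+ : ∀ {a} {A : Set a} (f : ℕ → A) m n →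
              applyUpTo f (m ℕ.+ n) ≡ applyUpTo f m ++ applyUpTo (f ∘ (m ℕ.+_)) n
applyUpTo-+ f zero    n = refl
applyUpTo-+ f (suc m) n = cong (f 0 ∷_) (applyUpTo-+ (f ∘ suc) m n)

upTo-+ : ∀ m n → upTo (m ℕ.+ n) ≡ upTo m ++ map (m ℕ.+_) (upTo n)
upTo-+ m n = ≡.trans (applyUpTo-+ id m n) (cong (upTo m ++_) (≡.sym (Listₚ.map-upTo (m ℕ.+_) n)))

filter-map : ∀ {a b p} {A : Set a} {B : Set b} {P : Pred B p} (P? : Decidable P) (f : A → B) xs →
             filter P? (map f xs) ≡ map f (filter (P? ∘ f) xs)
filter-map P? f []       = refl
filter-map P? f (x ∷ xs) with does (P? (f x))
... | true  = cong (f x ∷_) (filter-map P? f xs)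
... | false = filter-map P? f xs

units-double : ∀ {k} → 2 ℕD.∣ k → units (2 ℕ.* k) ≡ units k ++ map (k ℕ.+_) (units k)
units-double {k} 2∣k = begin
  filter unit₂ₖ? (upTo (k ℕ.+ (k ℕ.+ 0)))
    ≡⟨ cong (λ i → filter unit₂ₖ? (upTo (k ℕ.+ i))) (ℕₚ.+-identityʳ k) ⟩
  filter unit₂ₖ? (upTo (k ℕ.+ k))
    ≡⟨ cong (filter unit₂ₖ?) (upTo-+ k k) ⟩
  filter unit₂ₖ? (upTo k ++ map (k ℕ.+_) (upTo k))
    ≡⟨ Listₚ.filter-++ unit₂ₖ? (upTo k) _ ⟩
  filter unit₂ₖ? (upTo k) ++ filter unit₂ₖ? (map (k ℕ.+_) (upTo k))
    ≡⟨ cong (filter unit₂ₖ? (upTo k) ++_) (filter-map unit₂ₖ? (k ℕ.+_) (upTo k)) ⟩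
  filter unit₂ₖ? (upTo k) ++ map (k ℕ.+_) (filter (unit₂ₖ? ∘ (k ℕ.+_)) (upTo k))
    ≡⟨ cong₂ (λ xs ys → xs ++ map (k ℕ.+_) ys)
             (Listₚ.filter-≐ unit₂ₖ? unitₖ? (coprime-double 2∣k) (upTo k))
             (Listₚ.filter-≐ (unit₂ₖ? ∘ (k ℕ.+_)) unitₖ? shifted (upTo k)) ⟩
  units k ++ map (k ℕ.+_) (units k) ∎
  where
  open ≡.≡-Reasoning
  unit₂ₖ? : Decidable (λ h → Coprime h (2 ℕ.* k))
  unit₂ₖ? h = coprime? h (2 ℕ.* k)
  unitₖ? : Decidable (λ h → Coprime h k)
  unitₖ? h = coprime? h k
  shifted : (λ h → Coprime (k ℕ.+ h) (2 ℕ.* k)) ≐ (λ h → Coprime h k)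
  shifted = (λ c → proj₁ coprime-shift (proj₁ (coprime-double 2∣k) c))
          , (λ c → proj₂ (coprime-double 2∣k) (proj₂ coprime-shift c))

module _ where
  open import Data.Integer using (_+_; _*_; _-_; -_)

  phase : ℤ → ℤ → ℕ → ℤ → ℤ
  phase n m h x = - n * + h + m * x

  NegInvMod : ℕ → ℕ → (ℕ → ℤ) → Set
  NegInvMod N N′ inv = ∀ {h} → Coprime h N → + N′ ∣ + h * inv h + + 1

  -- Relies on x - (- + 1) and x + + 1 being definitionally equal.
  IsNegInvChoice⇒NegInvMod : ∀ {N M N′ inv} → N′ ℕD.∣ M → IsNegInvChoice N M inv → NegInvMod N N′ inv
  IsNegInvChoice⇒NegInvMod {M = M} {N′} N′∣M inv-spec {h} h⊥N =
    ℤS.∣-trans (ℤS.∣ᵤ⇒∣ {+ N′} {+ M} N′∣M) (ℤS.∣ᵤ⇒∣ (inv-spec h h⊥N))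

  coprime-∣-cancel : ∀ {N h} x → Coprime h N → + N ∣ + h * x → + N ∣ x
  coprime-∣-cancel {N} {h} x h⊥N N∣hx =
    ℤS.∣ᵤ⇒∣ (ℤC.coprime-divisor (+ N) (+ h) x (ℕC.sym h⊥N) (ℤS.∣⇒∣ᵤ N∣hx))

  negInv-unique : ∀ {N h x y} → Coprime h N → + N ∣ + h * x + + 1 → + N ∣ + h * y + + 1 → + N ∣ x - y
  negInv-unique {N} {h} {x} {y} h⊥N N∣hx+1 N∣hy+1 =
    coprime-∣-cancel (x - y) h⊥N (≡.subst (+ N ∣_) (difference (+ h) x y) (ℤS.∣m∣n⇒∣m-n N∣hx+1 N∣hy+1))
    where
    difference : ∀ h x y → (h * x + + 1) - (h * y + + 1) ≡ h * (x - y)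
    difference = solve-∀

  phase-cong : ∀ n m {N h x y} → Coprime h N → + N ∣ + h * x + + 1 → + N ∣ + h * y + + 1 →
               + N ∣ phase n m h x - phase n m h y
  phase-cong n m {N} {h} {x} {y} h⊥N N∣hx+1 N∣hy+1 =
    ≡.subst (+ N ∣_) (≡.sym (difference n m (+ h) x y)) (ℤS.∣n⇒∣m*n m (negInv-unique h⊥N N∣hx+1 N∣hy+1))
    where
    difference : ∀ n m h x y → (- n * h + m * x) - (- n * h + m * y) ≡ m * (x - y)
    difference = solve-∀

  odd⇒2∣pred : ∀ n → ¬ (+ 2 ℤD.∣ n) → + 2 ∣ n - + 1
  odd⇒2∣pred n 2∤n = divides (n /ℕ 2) (≡.trans (cong (_- + 1) n≡1+2q) (cancel (n /ℕ 2)))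
    where
    cancel : ∀ q → (+ 1 + q * + 2) - + 1 ≡ q * + 2
    cancel = solve-∀
    n≡1+2q : n ≡ + 1 + (n /ℕ 2) * + 2
    n≡1+2q with n %ℕ 2 | n%ℕd<d n 2 | a≡a%ℕn+[a/ℕn]*n n 2
    ... | 0           | _             | n≡2q   =
      ⊥-elim (2∤n (ℤS.∣⇒∣ᵤ (divides (n /ℕ 2) (≡.trans n≡2q (ℤₚ.+-identityˡ _)))))
    ... | 1           | _             | n≡1+2q = n≡1+2q
    ... | suc (suc _) | s≤s (s≤s ()) | _

  coprime-even⇒odd : ∀ {h k} → 2 ℕD.∣ k → Coprime h k → ¬ (+ 2 ℤD.∣ + h)
  coprime-even⇒odd 2∣k h⊥k 2∣h with h⊥k (2∣h , 2∣k)
  ... | ()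

  2∣⇒2k∣k* : ∀ k {a} → + 2 ∣ a → + (2 ℕ.* k) ∣ + k * a
  2∣⇒2k∣k* k {a} 2∣a = ≡.subst (_∣ + k * a) k*2≡2k (ℤS.*-monoʳ-∣ (+ k) 2∣a)
    where
    k*2≡2k : + k * + 2 ≡ + (2 ℕ.* k)
    k*2≡2k = ≡.trans (ℤₚ.*-comm (+ k) (+ 2)) (≡.sym (ℤₚ.pos-* 2 k))

  negInv-shift : ∀ {k h x y} → 2 ℕD.∣ k → Coprime h k →
                 + (2 ℕ.* k) ∣ + h * x + + 1 → + (2 ℕ.* k) ∣ + (k ℕ.+ h) * y + + 1 →
                 + (2 ℕ.* k) ∣ (y - x) - + k
  negInv-shift {k} {h} {x} {y} 2∣k h⊥k 2k∣hx+1 2k∣[k+h]y+1 =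
    coprime-∣-cancel ((y - x) - + k) (proj₂ (coprime-double 2∣k) h⊥k)
      (≡.subst (+ (2 ℕ.* k) ∣_) (≡.sym (h[y-x-k] (+ k) (+ h) x y))
        (ℤS.∣m∣n⇒∣m-n (ℤS.∣m∣n⇒∣m-n 2k∣[k+h]y+1′ 2k∣hx+1) (2∣⇒2k∣k* k 2∣y+h)))
    where
    h[y-x-k] : ∀ k h x y → h * ((y - x) - k) ≡ (((k + h) * y + + 1) - (h * x + + 1)) - k * (y + h)
    h[y-x-k] = solve-∀
    y+h : ∀ k h y → y + h ≡ (((k + h) * y + + 1) - (k + (h - + 1)) * y) + (h - + 1)
    y+h = solve-∀
    2k∣[k+h]y+1′ : + (2 ℕ.* k) ∣ (+ k + + h) * y + + 1
    2k∣[k+h]y+1′ = ≡.subst (λ z → + (2 ℕ.* k) ∣ z * y + + 1) (ℤₚ.pos-+ k h) 2k∣[k+h]y+1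
    2∣+k : + 2 ∣ + k
    2∣+k = ℤS.∣ᵤ⇒∣ 2∣k
    2∣h-1 : + 2 ∣ + h - + 1
    2∣h-1 = odd⇒2∣pred (+ h) (coprime-even⇒odd 2∣k h⊥k)
    2∣y+h : + 2 ∣ y + + h
    2∣y+h = ≡.subst (+ 2 ∣_) (≡.sym (y+h (+ k) (+ h) y))
      (ℤS.∣m∣n⇒∣m+n (ℤS.∣m∣n⇒∣m-n (ℤS.∣-trans (ℤS.∣ᵤ⇒∣ (ℕD.m∣m*n k)) 2k∣[k+h]y+1′)
                                  (ℤS.∣m⇒∣m*n y (ℤS.∣m∣n⇒∣m+n 2∣+k 2∣h-1)))
                    2∣h-1)

  phase-shift : ∀ n m {k h x y} → 2 ℕD.∣ k → ¬ (+ 2 ℤD.∣ n) → ¬ (+ 2 ℤD.∣ m) → Coprime h k →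
                + (2 ℕ.* k) ∣ + h * x + + 1 → + (2 ℕ.* k) ∣ + (k ℕ.+ h) * y + + 1 →
                + (2 ℕ.* k) ∣ phase n m (k ℕ.+ h) y - phase n m h x
  phase-shift n m {k} {h} {x} {y} 2∣k 2∤n 2∤m h⊥k 2k∣hx+1 2k∣[k+h]y+1 =
    ≡.subst (+ (2 ℕ.* k) ∣_) (≡.sym split)
      (ℤS.∣m∣n⇒∣m+n (2∣⇒2k∣k* k 2∣m-n) (ℤS.∣n⇒∣m*n m (negInv-shift 2∣k h⊥k 2k∣hx+1 2k∣[k+h]y+1)))
    where
    telescope : ∀ m n → (m - + 1) - (n - + 1) ≡ m - n
    telescope = solve-∀
    2∣m-n : + 2 ∣ m - n
    2∣m-n = ≡.subst (+ 2 ∣_) (telescope m n) (ℤS.∣m∣n⇒∣m-n (odd⇒2∣pred m 2∤m) (odd⇒2∣pred n 2∤n))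
    difference : ∀ n m k h x y →
                 (- n * (k + h) + m * y) - (- n * h + m * x) ≡ k * (m - n) + m * ((y - x) - k)
    difference = solve-∀
    split : phase n m (k ℕ.+ h) y - phase n m h x ≡ + k * (m - n) + m * ((y - x) - + k)
    split = ≡.trans (cong (λ z → (- n * z + m * y) - phase n m h x) (ℤₚ.pos-+ k h))
                    (difference n m (+ k) (+ h) x y)

toℚᵘ-frac : ∀ a d → ℚ.toℚᵘ (frac a (suc d)) ≃ mkℚᵘ a d
toℚᵘ-frac a d = ℚₚ.toℚᵘ-fromℚᵘ (mkℚᵘ a d)

≡-viaℚᵘ : ∀ {p q x y} → ℚ.toℚᵘ p ≃ x → ℚ.toℚᵘ q ≃ y → x ≃ y → p ≡ q
≡-viaℚᵘ p≃x q≃y x≃y = ℚₚ.toℚᵘ-injective (ℚᵘₚ.≃-trans p≃x (ℚᵘₚ.≃-trans x≃y (ℚᵘₚ.≃-sym q≃y)))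

ι-+ : ∀ a b → ι (a ℤ.+ b) ≡ ι a ℚ.+ ι b
ι-+ a b = ≡-viaℚᵘ (toℚᵘ-frac (a ℤ.+ b) 0)
  (ℚᵘₚ.≃-trans (ℚₚ.toℚᵘ-homo-+ (ι a) (ι b)) (ℚᵘₚ.+-cong (toℚᵘ-frac a 0) (toℚᵘ-frac b 0)))
  (*≡* (identity a b))
  where
  identity : ∀ a b → (a ℤ.+ b) ℤ.* + 1 ≡ (a ℤ.* + 1 ℤ.+ b ℤ.* + 1) ℤ.* + 1
  identity = solve-∀

ι-* : ∀ a b → ι (a ℤ.* b) ≡ ι a ℚ.* ι b
ι-* a b = ≡-viaℚᵘ (toℚᵘ-frac (a ℤ.* b) 0)
  (ℚᵘₚ.≃-trans (ℚₚ.toℚᵘ-homo-* (ι a) (ι b)) (ℚᵘₚ.*-cong (toℚᵘ-frac a 0) (toℚᵘ-frac b 0)))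
  (*≡* refl)

ι-neg : ∀ a → ι (ℤ.- a) ≡ ℚ.- ι a
ι-neg a = ≡-viaℚᵘ (toℚᵘ-frac (ℤ.- a) 0)
  (ℚᵘₚ.≃-trans (ℚₚ.toℚᵘ-homo‿- (ι a)) (ℚᵘₚ.-‿cong (toℚᵘ-frac a 0)))
  (*≡* refl)

ι*frac1 : ∀ a d → ι a ℚ.* frac (+ 1) (suc d) ≡ frac a (suc d)
ι*frac1 a d = ≡-viaℚᵘ
  (ℚᵘₚ.≃-trans (ℚₚ.toℚᵘ-homo-* (ι a) (frac (+ 1) (suc d)))
               (ℚᵘₚ.*-cong (toℚᵘ-frac a 0) (toℚᵘ-frac (+ 1) d)))
  (toℚᵘ-frac a d)
  (*≡* (cong₂ ℤ._*_ (ℤₚ.*-identityʳ a) (cong +_ (≡.sym (ℕₚ.*-identityˡ (suc d))))))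

frac1*frac1 : ∀ c d → frac (+ 1) (suc c) ℚ.* frac (+ 1) (suc d) ≡ frac (+ 1) (suc c ℕ.* suc d)
frac1*frac1 c d = ≡-viaℚᵘ
  (ℚᵘₚ.≃-trans (ℚₚ.toℚᵘ-homo-* (frac (+ 1) (suc c)) (frac (+ 1) (suc d)))
               (ℚᵘₚ.*-cong (toℚᵘ-frac (+ 1) c) (toℚᵘ-frac (+ 1) d)))
  (toℚᵘ-frac (+ 1) _)
  (*≡* refl)

frac-shift : ∀ a b t d → a ℤ.- b ≡ t ℤ.* + suc d → frac a (suc d) ≡ frac b (suc d) ℚ.+ ι t
frac-shift a b t d a-b≡tN = ≡-viaℚᵘ (toℚᵘ-frac a d)
  (ℚᵘₚ.≃-trans (ℚₚ.toℚᵘ-homo-+ (frac b (suc d)) (ι t)) (ℚᵘₚ.+-cong (toℚᵘ-frac b d) (toℚᵘ-frac t 0)))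
  (*≡* (begin
    a ℤ.* + (suc d ℕ.* 1)               ≡⟨ cong (λ i → a ℤ.* + i) (ℕₚ.*-identityʳ (suc d)) ⟩
    a ℤ.* N                             ≡⟨ regroup a b N ⟩
    (b ℤ.* + 1 ℤ.+ (a ℤ.- b)) ℤ.* N     ≡⟨ cong (λ z → (b ℤ.* + 1 ℤ.+ z) ℤ.* N) a-b≡tN ⟩
    (b ℤ.* + 1 ℤ.+ t ℤ.* N) ℤ.* N       ∎))
  where
  open ≡.≡-Reasoning
  N = + suc d
  regroup : ∀ a b N → a ℤ.* N ≡ (b ℤ.* + 1 ℤ.+ (a ℤ.- b)) ℤ.* N
  regroup = solve-∀

ι-phase : ∀ n m h x → ι (phase n m h x) ≡ (ℚ.- ι n) ℚ.* ι (+ h) ℚ.+ ι m ℚ.* ι x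
ι-phase n m h x = ≡.trans (ι-+ (ℤ.- n ℤ.* + h) (m ℤ.* x))
  (cong₂ ℚ._+_ (≡.trans (ι-* (ℤ.- n) (+ h)) (cong (ℚ._* ι (+ h)) (ι-neg n))) (ι-* m x))

phase-frac : ∀ n m h x d →
  ((ℚ.- ι n) ℚ.* ι (+ h) ℚ.+ ι m ℚ.* ι x) ℚ.* frac (+ 1) (suc d) ≡ frac (phase n m h x) (suc d)
phase-frac n m h x d =
  ≡.trans (cong (ℚ._* frac (+ 1) (suc d)) (≡.sym (ι-phase n m h x))) (ι*frac1 (phase n m h x) d)

phase-frac-neg : ∀ n m h x d →
  ℚ.- ((ι n ℚ.* ι (+ h) ℚ.- ι m ℚ.* ι x) ℚ.* frac (+ 1) (suc d)) ≡ frac (phase n m h x) (suc d)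
phase-frac-neg n m h x d =
  ≡.trans (rearrange (ι n) (ι (+ h)) (ι m) (ι x) (frac (+ 1) (suc d))) (phase-frac n m h x d)
  where
  open +-*-Solver
  rearrange : ∀ u H v X f → ℚ.- ((u ℚ.* H ℚ.- v ℚ.* X) ℚ.* f) ≡ ((ℚ.- u) ℚ.* H ℚ.+ v ℚ.* X) ℚ.* f
  rearrange = solve 5 (λ u H v X f → :- ((u :* H :- v :* X) :* f) := ((:- u) :* H :+ v :* X) :* f) refl

phase-frac-half : ∀ n m h x d →
  ((ℚ.- frac n 2) ℚ.* ι (+ h) ℚ.+ frac m 2 ℚ.* ι x) ℚ.* frac (+ 1) (suc d)
    ≡ frac (phase n m h x) (2 ℕ.* suc d)
phase-frac-half n m h x d = begin
  ((ℚ.- frac n 2) ℚ.* ι (+ h) ℚ.+ frac m 2 ℚ.* ι x) ℚ.* f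
    ≡⟨ cong₂ (λ u v → ((ℚ.- u) ℚ.* ι (+ h) ℚ.+ v ℚ.* ι x) ℚ.* f)
             (≡.sym (ι*frac1 n 1)) (≡.sym (ι*frac1 m 1)) ⟩
  ((ℚ.- (ι n ℚ.* ½)) ℚ.* ι (+ h) ℚ.+ (ι m ℚ.* ½) ℚ.* ι x) ℚ.* f
    ≡⟨ rearrange (ι n) (ι m) ½ (ι (+ h)) (ι x) f ⟩
  ((ℚ.- ι n) ℚ.* ι (+ h) ℚ.+ ι m ℚ.* ι x) ℚ.* (½ ℚ.* f)
    ≡⟨ cong (((ℚ.- ι n) ℚ.* ι (+ h) ℚ.+ ι m ℚ.* ι x) ℚ.*_) (frac1*frac1 1 d) ⟩
  ((ℚ.- ι n) ℚ.* ι (+ h) ℚ.+ ι m ℚ.* ι x) ℚ.* frac (+ 1) (2 ℕ.* suc d)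
    ≡⟨ phase-frac n m h x _ ⟩
  frac (phase n m h x) (2 ℕ.* suc d) ∎
  where
  open ≡.≡-Reasoning
  open +-*-Solver
  ½ = frac (+ 1) 2
  f = frac (+ 1) (suc d)
  rearrange : ∀ u v t H X f →
              ((ℚ.- (u ℚ.* t)) ℚ.* H ℚ.+ (v ℚ.* t) ℚ.* X) ℚ.* f ≡ ((ℚ.- u) ℚ.* H ℚ.+ v ℚ.* X) ℚ.* (t ℚ.* f)
  rearrange = solve 6 (λ u v t H X f →
    ((:- (u :* t)) :* H :+ (v :* t) :* X) :* f := ((:- u) :* H :+ v :* X) :* (t :* f)) refl

module CharacterSums {c ℓ : Level} (R : CommutativeRing c ℓ) (χ : Character R) where
  open CommutativeRing R renaming (refl to ≈-refl)
  open Character χ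
  open Sums R χ
  open import Relation.Binary.Reasoning.Setoid setoid

  e[_/_] : ℤ → ℕ → Carrier
  e[ a / N ] = e (frac a N)

  Kl-term : ℚ → ℚ → (ℕ → ℤ) → ℕ → ℕ → Carrier
  Kl-term p q h′ N h = e (((ℚ.- p) ℚ.* ι (+ h) ℚ.+ q ℚ.* ι (h′ h)) ℚ.* frac (+ 1) N)

  H-term : ℤ → ℤ → (ℕ → ℤ) → ℕ → ℕ → Carrier
  H-term n m w N h = e (ℚ.- ((ι n ℚ.* ι (+ h) ℚ.- ι m ℚ.* ι (w h)) ℚ.* frac (+ 1) N))

  e-periodic : ∀ a b d → + suc d ∣ a ℤ.- b → e[ a / suc d ] ≈ e[ b / suc d ]
  e-periodic a b d (divides t a-b≡tN) = begin
    e (frac a (suc d))                 ≡⟨ cong e (frac-shift a b t d a-b≡tN) ⟩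
    e (frac b (suc d) ℚ.+ ι t)         ≈⟨ e-hom (frac b (suc d)) (ι t) ⟩
    e (frac b (suc d)) * e (ι t)       ≈⟨ *-congˡ (e-int t) ⟩
    e (frac b (suc d)) * 1#            ≈⟨ *-identityʳ _ ⟩
    e (frac b (suc d))                 ∎

  Σ-cong : ∀ {F G : ℕ → Carrier} {xs} → All (λ x → F x ≈ G x) xs → Σ[ xs ] F ≈ Σ[ xs ] G
  Σ-cong []             = ≈-refl
  Σ-cong (Fx≈Gx ∷ rest) = +-cong Fx≈Gx (Σ-cong rest)

  Σ-++ : ∀ xs ys F → Σ[ xs ++ ys ] F ≈ Σ[ xs ] F + Σ[ ys ] F
  Σ-++ []       ys F = sym (+-identityˡ _)
  Σ-++ (x ∷ xs) ys F = trans (+-congˡ (Σ-++ xs ys F)) (sym (+-assoc _ _ _))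

  Σ-map : ∀ f xs F → Σ[ map f xs ] F ≡ Σ[ xs ] (F ∘ f)
  Σ-map f []       F = refl
  Σ-map f (x ∷ xs) F = cong (λ s → F (f x) + s) (Σ-map f xs F)

  Σ-units-cong : ∀ N {F G} → (∀ {h} → Coprime h N → F h ≈ G h) → Σ[ units N ] F ≈ Σ[ units N ] G
  Σ-units-cong N F≈G = Σ-cong (All.map F≈G (all-filter (λ h → coprime? h N) (upTo N)))

  Σ-units-double : ∀ {k} → 2 ℕD.∣ k → ∀ F →
                   Σ[ units (2 ℕ.* k) ] F ≈ Σ[ units k ] F + Σ[ units k ] (F ∘ (k ℕ.+_))
  Σ-units-double {k} 2∣k F = begin
    Σ[ units (2 ℕ.* k) ] F
      ≡⟨ cong (λ xs → Σ[ xs ] F) (units-double 2∣k) ⟩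
    Σ[ units k ++ map (k ℕ.+_) (units k) ] F
      ≈⟨ Σ-++ (units k) _ F ⟩
    Σ[ units k ] F + Σ[ map (k ℕ.+_) (units k) ] F
      ≡⟨ cong (λ s → Σ[ units k ] F + s) (Σ-map (k ℕ.+_) (units k) F) ⟩
    Σ[ units k ] F + Σ[ units k ] (F ∘ (k ℕ.+_)) ∎

  Kl₁≡Σ : ∀ k h′ p q → Kl k 1 h′ p q ≡ Σ[ units k ] (Kl-term p q h′ k)
  Kl₁≡Σ k h′ p q = cong (λ N → Σ[ units N ] (Kl-term p q h′ N)) (ℕₚ.*-identityˡ k)

  -- The left-hand side is Kl k a h′ (ι n) (ι m) whenever a ℕ.* k normalises to suc d.
  Kl≈H : ∀ d n m {h′ w} → NegInvMod (suc d) (suc d) h′ → NegInvMod (suc d) (suc d) w →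
         Σ[ units (suc d) ] (Kl-term (ι n) (ι m) h′ (suc d)) ≈ H (suc d) w n m
  Kl≈H d n m {h′} {w} h′-inv w-inv = Σ-units-cong (suc d) λ {h} h⊥N → begin
    Kl-term (ι n) (ι m) h′ (suc d) h
      ≡⟨ cong e (phase-frac n m h (h′ h) d) ⟩
    e[ phase n m h (h′ h) / suc d ]
      ≈⟨ e-periodic (phase n m h (h′ h)) (phase n m h (w h)) d
                    (phase-cong n m h⊥N (h′-inv h⊥N) (w-inv h⊥N)) ⟩
    e[ phase n m h (w h) / suc d ]
      ≡⟨ cong e (phase-frac-neg n m h (w h) d) ⟨
    H-term n m w (suc d) h ∎

  double-Kl₁-half≈Kl₂ : ∀ k .{{_ : NonZero k}} → 2 ℕD.∣ k → ∀ n m → ¬ (+ 2 ℤD.∣ n) → ¬ (+ 2 ℤD.∣ m) →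
    ∀ {h′₁ h′₂} → NegInvMod k (2 ℕ.* k) h′₁ → NegInvMod (2 ℕ.* k) (2 ℕ.* k) h′₂ →
    (1# + 1#) * Kl k 1 h′₁ (frac n 2) (frac m 2) ≈ Kl k 2 h′₂ (ι n) (ι m)
  double-Kl₁-half≈Kl₂ k@(suc j) 2∣k n m 2∤n 2∤m {h′₁} {h′₂} h′₁-inv h′₂-inv = begin
    (1# + 1#) * Kl k 1 h′₁ (frac n 2) (frac m 2)
      ≡⟨ cong ((1# + 1#) *_) (Kl₁≡Σ k h′₁ (frac n 2) (frac m 2)) ⟩
    (1# + 1#) * Σ[ units k ] (Kl-term (frac n 2) (frac m 2) h′₁ k)
      ≈⟨ *-congˡ (Σ-units-cong k λ {h} _ → reflexive (cong e (phase-frac-half n m h (h′₁ h) j))) ⟩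
    (1# + 1#) * Σ[ units k ] K₁
      ≈⟨ trans (distribʳ _ 1# 1#) (+-cong (*-identityˡ _) (*-identityˡ _)) ⟩
    Σ[ units k ] K₁ + Σ[ units k ] K₁
      ≈⟨ +-cong (Σ-units-cong k K₂≈K₁) (Σ-units-cong k K₂[k+h]≈K₁) ⟨
    Σ[ units k ] K₂ + Σ[ units k ] (K₂ ∘ (k ℕ.+_))
      ≈⟨ Σ-units-double 2∣k K₂ ⟨
    Σ[ units (2 ℕ.* k) ] K₂
      ≈⟨ Σ-units-cong (2 ℕ.* k) (λ {h} _ → reflexive (cong e (phase-frac n m h (h′₂ h) _))) ⟨
    Kl k 2 h′₂ (ι n) (ι m) ∎
    where
    K₁ K₂ : ℕ → Carrier
    K₁ h = e[ phase n m h (h′₁ h) / 2 ℕ.* k ]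
    K₂ h = e[ phase n m h (h′₂ h) / 2 ℕ.* k ]
    K₂≈K₁ : ∀ {h} → Coprime h k → K₂ h ≈ K₁ h
    K₂≈K₁ {h} h⊥k = e-periodic (phase n m h (h′₂ h)) (phase n m h (h′₁ h)) _
      (phase-cong n m h⊥2k (h′₂-inv h⊥2k) (h′₁-inv h⊥k))
      where h⊥2k = proj₂ (coprime-double 2∣k) h⊥k
    K₂[k+h]≈K₁ : ∀ {h} → Coprime h k → K₂ (k ℕ.+ h) ≈ K₁ h
    K₂[k+h]≈K₁ {h} h⊥k = e-periodic (phase n m (k ℕ.+ h) y) (phase n m h x) _
      (phase-shift n m 2∣k 2∤n 2∤m h⊥k (h′₁-inv h⊥k) (h′₂-inv k+h⊥2k))
      where
      x = h′₁ h
      y = h′₂ (k ℕ.+ h)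
      k+h⊥2k = proj₂ (coprime-double 2∣k) (proj₂ coprime-shift h⊥k)

theorem2p5 : ∀ {c ℓ : Level} (R : CommutativeRing c ℓ) (χ : Character R) →
    let open CommutativeRing R in
    let open Sums R χ in
    (k : ℕ) → NonZero k → 2 ℕD.∣ k →
    (n m : ℤ) → ¬ ((+ 2) ℤD.∣ n) → ¬ ((+ 2) ℤD.∣ m) →
    (h'₁ h'₂ w₁ w₂ : ℕ → ℤ) →
    IsNegInvChoice k (kstar k) h'₁ → IsNegInvChoice (2 ℕ.* k) (kstar k) h'₂ →
    IsNegInvChoice k k w₁ → IsNegInvChoice (2 ℕ.* k) (2 ℕ.* k) w₂ →
    (((1# + 1#) * Kl k 1 h'₁ (frac n 2) (frac m 2) ≈ Kl k 2 h'₂ (ι n) (ι m))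
      × (Kl k 2 h'₂ (ι n) (ι m) ≈ H (2 ℕ.* k) w₂ n m))
      × (Kl k 1 h'₁ (ι n) (ι m) ≈ H k w₁ n m)
theorem2p5 R χ k@(suc j) _ 2∣k n m 2∤n 2∤m h′₁ h′₂ w₁ w₂ h′₁-inv h′₂-inv w₁-inv w₂-inv =
    ( double-Kl₁-half≈Kl₂ k 2∣k n m 2∤n 2∤m (mod-2k h′₁-inv) (mod-2k h′₂-inv)
    , Kl≈H _ n m (mod-2k h′₂-inv) (mod-self w₂-inv) )
  , trans (reflexive (Kl₁≡Σ k h′₁ (ι n) (ι m))) (Kl≈H j n m (mod-k h′₁-inv) (mod-self w₁-inv))
  where
  open CommutativeRing R using (trans; reflexive)
  open CharacterSums R χ
  mod-self : ∀ {N inv} → IsNegInvChoice N N inv → NegInvMod N N inv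
  mod-self = IsNegInvChoice⇒NegInvMod ℕD.∣-refl
  mod-2k : ∀ {N inv} → IsNegInvChoice N (kstar k) inv → NegInvMod N (2 ℕ.* k) inv
  mod-2k = IsNegInvChoice⇒NegInvMod (2k∣kstar k)
  mod-k : ∀ {N inv} → IsNegInvChoice N (kstar k) inv → NegInvMod N k inv
  mod-k = IsNegInvChoice⇒NegInvMod (ℕD.∣-trans (ℕD.n∣m*n 2) (2k∣kstar k))
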